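{- Let $p$ be a prime, $q=p^s$, let $d,m$ be positive integers with $q>d\ge m+2$, let $G_1,\dots,G_m\in\mathbb{F}_q[A_{d-1},\dots,A_1]$, and let $\mathcal{A}:=\{T^d+a_{d-1}T^{d-1}+\cdots+a_1T\in\mathbb{F}_q[T]:\ G_i(a_{d-1},\dots,a_1)=0\ (1\le i\le m)\}$, assumed nonempty. Then $$\mathcal{V}(\mathcal{A})=\frac{1}{|\mathcal{A}|}\sum_{r=1}^d(-1)^{r-1}\sum_{\mathcal{X}_r\subset\mathbb{F}_q}|\mathcal{S}^{\mathcal{A}}_{\mathcal{X}_r}|,$$ where the inner sum runs over all subsets $\mathcal{X}_r\subset\mathbb{F}_q$ with exactly $r$ elements.
   Context: $\mathbb{F}_q$ is the field with $q$ elements. For $f\in\mathbb{F}_q[T]$, $\mathcal{V}(f):=|\{f(c):c\in\mathbb{F}_q\}|$ and $\mathcal{V}(\mathcal{A}):=\frac{1}{|\mathcal{A}|}\sum_{f\in\mathcal{A}}\mathcal{V}(f)$. For $\mathcal{X}\subset\mathbb{F}_q$, $\mathcal{S}^{\mathcal{A}}_{\mathcal{X}}:=\{f+a_0:\ f\in\mathcal{A},\ a_0\in\mathbb{F}_q,\ (f+a_0)(x)=0\text{ for all }x\in\mathcal{X}\}\subset\mathbb{F}_q[T]$. -}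

module Defs where

open import Level using (0ℓ)
open import Data.Nat as ℕ using (ℕ; zero; suc; _∸_; NonZero)
open import Data.Fin using (Fin; toℕ)
open import Data.Vec using (Vec; []; _∷_; lookup)
open import Data.List as List using (List; []; _∷_; length; map; filter; concatMap; upTo; foldr)
open import Data.List.Membership.Propositional using (_∈_)
open import Data.List.Relation.Unary.Unique.Propositional using (Unique)
open import Data.List.Relation.Unary.All using (All; all?)
open import Data.List.Relation.Unary.Any using (any?)
open import Data.Product using (Σ; _×_; _,_)
open import Data.Nat.ListAction renaming (sum to sumℕ)
open import Data.Integer as ℤ using (ℤ; +_)
open import Data.Rational as ℚ using (ℚ)
open import Algebra.Structures using (IsCommutativeRing)
open import Relation.Binary.PropositionalEquality using (_≡_; _≢_)
open import Relation.Binary.Definitions using (DecidableEquality)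
open import Relation.Nullary using (Dec; yes; no; _×-dec_)

record FiniteField : Set₁ where
  infixl 6 _+_
  infixl 7 _*_
  field
    F     : Set
    _+_   : F → F → F
    _*_   : F → F → F
    -_    : F → F
    0#    : F
    1#    : F
    isCommutativeRing : IsCommutativeRing _≡_ _+_ _*_ -_ 0# 1#
    0≢1   : 0# ≢ 1#
    inverse : ∀ x → x ≢ 0# → Σ F (λ y → x * y ≡ 1#)
    _≟_   : DecidableEquality F
    elems : List F
    elems-unique   : Unique elems
    elems-complete : ∀ x → x ∈ elems

  card : ℕ
  card = length elems

  _^_ : F → ℕ → F
  x ^ zero  = 1#
  x ^ suc n = x * (x ^ n)

module _ (K : FiniteField) where
  open FiniteField K

  data MPoly (n : ℕ) : Set where
    con  : F → MPoly n
    var  : Fin n → MPoly n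
    _⊕_  : MPoly n → MPoly n → MPoly n
    _⊗_  : MPoly n → MPoly n → MPoly n

  eval : ∀ {n} → MPoly n → Vec F n → F
  eval (con c) a = c
  eval (var i) a = lookup a i
  eval (p ⊕ r) a = eval p a + eval r a
  eval (p ⊗ r) a = eval p a * eval r a

  allVecs : (n : ℕ) → List (Vec F n)
  allVecs zero    = [] ∷ []
  allVecs (suc n) = concatMap (λ x → map (x ∷_) (allVecs n)) elems

  -- All sublists of length r of a list (for the duplicate-free list
  -- 'elems' these are exactly the r-element subsets of F).
  choose : ∀ {A : Set} → ℕ → List A → List (List A)
  choose zero    xs       = [] ∷ []
  choose (suc r) []       = []
  choose (suc r) (x ∷ xs) = map (x ∷_) (choose r xs) List.++ choose (suc r) xs

  -- The polynomial T^d + a_{d-1} T^{d-1} + ... + a_1 T, given by the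
  -- coefficient vector a : Vec F (d ∸ 1) with  lookup a i = a_{d-1-i},
  -- i.e. a = (a_{d-1}, ..., a_1); evaluated at c.
  evalF : (d : ℕ) → Vec F (d ∸ 1) → F → F
  evalF d a c = (c ^ d) + go a
    where
    go : ∀ {k} → Vec F k → F
    go {zero}  []       = 0#
    go {suc k} (x ∷ xs) = (x * (c ^ suc k)) + go xs

  V : (d : ℕ) → Vec F (d ∸ 1) → ℕ
  V d a = length (filter (λ y → any? (λ c → evalF d a c ≟ y) elems) elems)

  InA : (d m : ℕ) → Vec (MPoly (d ∸ 1)) m → Vec F (d ∸ 1) → Set
  InA d m G a = All (λ g → eval g a ≡ 0#) (Data.Vec.toList G)

  inA? : (d m : ℕ) (G : Vec (MPoly (d ∸ 1)) m) (a : Vec F (d ∸ 1)) → Dec (InA d m G a)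
  inA? d m G a = all? (λ g → eval g a ≟ 0#) (Data.Vec.toList G)

  𝒜 : (d m : ℕ) → Vec (MPoly (d ∸ 1)) m → List (Vec F (d ∸ 1))
  𝒜 d m G = filter (inA? d m G) (allVecs (d ∸ 1))

  card𝒜 : (d m : ℕ) → Vec (MPoly (d ∸ 1)) m → ℕ
  card𝒜 d m G = length (𝒜 d m G)

  V𝒜 : (d m : ℕ) (G : Vec (MPoly (d ∸ 1)) m) → .{{NonZero (card𝒜 d m G)}} → ℚ
  V𝒜 d m G = (+ 1 ℚ./ card𝒜 d m G) ℚ.* ((+ sumℕ (map (V d) (𝒜 d m G))) ℚ./ 1)

  -- 𝒮^𝒜_X = { f + a₀ : f ∈ 𝒜, a₀ ∈ F, (f + a₀)(x) = 0 for all x ∈ X }.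
  -- Since every f ∈ 𝒜 has zero constant term, the map (f, a₀) ↦ f + a₀ is
  -- injective, so 𝒮^𝒜_X is enumerated by the pairs (a, a₀) below.
  𝒮 : (d m : ℕ) → Vec (MPoly (d ∸ 1)) m → List F → List (Vec F (d ∸ 1) × F)
  𝒮 d m G X =
    filter (λ { (a , a₀) → all? (λ x → (evalF d a x + a₀) ≟ 0#) X })
      (concatMap (λ a → map (a ,_) elems) (𝒜 d m G))

  inclExcl : (d m : ℕ) → Vec (MPoly (d ∸ 1)) m → ℤ
  inclExcl d m G =
    List.foldr ℤ._+_ (+ 0)
      (map (λ r → ((ℤ.- (+ 1)) ℤ.^ (r ∸ 1)) ℤ.*
                  (+ sumℕ (map (λ X → length (𝒮 d m G X)) (choose r elems))))
           (map suc (upTo d)))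

  RHS : (d m : ℕ) (G : Vec (MPoly (d ∸ 1)) m) → .{{NonZero (card𝒜 d m G)}} → ℚ
  RHS d m G = (+ 1 ℚ./ card𝒜 d m G) ℚ.* (inclExcl d m G ℚ./ 1)

{-# OPTIONS --safe #-}
module Submission where

-- For f ∈ 𝒜 and a₀ ∈ 𝔽_q let R(f, a₀) be the set of roots of f + a₀. Counting the pairs
-- ((f, a₀), 𝒳) with 𝒳 ⊆ R(f, a₀) and |𝒳| = r in two ways gives
--   Σ_{|𝒳| = r} |𝒮^𝒜_𝒳| = Σ_{(f, a₀)} C(|R(f, a₀)|, r).
-- As f + a₀ is monic of degree d, |R(f, a₀)| ≤ d, and then Σ_{r=1}^{d} (-1)^{r-1} C(|R|, r) is 1 if
-- R ≠ ∅ and 0 otherwise. So the alternating sum counts the pairs (f, a₀) for which -a₀ is a value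
-- of f; for fixed f there are 𝒱(f) of them.

open import Level using (0ℓ)
open import Defs
open import Algebra.Bundles using (CommutativeSemiring; CommutativeRing)
open import Data.Bool using (if_then_else_)
open import Data.Nat as ℕ using (ℕ; zero; suc; _≤_; _<_; _∸_; z≤n; s≤s; NonZero; ≢-nonZero)
import Data.Nat.Properties as ℕP
open import Data.Nat.ListAction renaming (sum to sumℕ)
open import Data.Nat.ListAction.Properties using (sum-↭)
open import Data.Nat.Primality using (Prime)
open import Data.Integer as ℤ using (ℤ; +_)
import Data.Integer.Properties as ℤP
import Data.Rational as ℚ
open import Data.List as List using (List; []; _∷_; _++_; map; filter; concatMap; length; upTo)
open import Data.List.Properties using (map-∘; map-++; map-cong; map-upTo; length-++; length-map; filter-++)
open import Data.List.Membership.Propositional using (_∈_)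
open import Data.List.Membership.Propositional.Properties using (∈-map⁺)
open import Data.List.Membership.Propositional.Properties.WithK using (unique∧set⇒bag)
open import Data.List.Relation.Binary.BagAndSetEquality using (∼bag⇒↭)
open import Data.List.Relation.Binary.Permutation.Propositional using (_↭_)
import Data.List.Relation.Binary.Permutation.Propositional.Properties as ↭
open import Data.List.Relation.Unary.All as All using (All; _∷_; all?)
open import Data.List.Relation.Unary.All.Properties using (all-filter)
open import Data.List.Relation.Unary.Any as Any using (any?)
open import Data.List.Relation.Unary.AllPairs using (_∷_)
open import Data.List.Relation.Unary.Unique.Propositional using (Unique)
import Data.List.Relation.Unary.Unique.Propositional.Properties as Unique
open import Data.Product using (Σ-syntax; _×_; _,_)
open import Data.Vec using (Vec; []; _∷_)
open import Function.Bundles using (_⇔_; mk⇔)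
open import Relation.Binary.PropositionalEquality
  using (_≡_; _≢_; refl; sym; trans; cong; cong₂; subst; module ≡-Reasoning)
open import Relation.Nullary using (Dec; yes; no; does; ¬_; contradiction)
open import Relation.Nullary.Decidable using (does-⇔)
open import Relation.Unary using (Decidable)

module ListSum {c ℓ} (R : CommutativeSemiring c ℓ) where
  open CommutativeSemiring R renaming (refl to ≈-refl; sym to ≈-sym; trans to ≈-trans)
  open import Relation.Binary.Reasoning.Setoid setoid
  open import Algebra.Properties.CommutativeSemigroup +-commutativeSemigroup using (interchange)

  sum : List Carrier → Carrier
  sum = List.foldr _+_ 0#

  sum-++ : ∀ xs ys → sum (xs ++ ys) ≈ sum xs + sum ys
  sum-++ []       ys = ≈-sym (+-identityˡ _)
  sum-++ (x ∷ xs) ys = ≈-trans (+-congˡ (sum-++ xs ys)) (≈-sym (+-assoc x _ _))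

  private variable A B : Set

  sum-map-zero : {f : A → Carrier} → (∀ x → f x ≈ 0#) → ∀ xs → sum (map f xs) ≈ 0#
  sum-map-zero f≈0 []       = ≈-refl
  sum-map-zero f≈0 (x ∷ xs) = ≈-trans (+-cong (f≈0 x) (sum-map-zero f≈0 xs)) (+-identityˡ 0#)

  sum-map-+ : ∀ (f g : A → Carrier) xs →
              sum (map (λ x → f x + g x) xs) ≈ sum (map f xs) + sum (map g xs)
  sum-map-+ f g []       = ≈-sym (+-identityˡ 0#)
  sum-map-+ f g (x ∷ xs) = ≈-trans (+-congˡ (sum-map-+ f g xs)) (interchange (f x) (g x) _ _)

  sum-map-*ˡ : ∀ a (f : A → Carrier) xs → sum (map (λ x → a * f x) xs) ≈ a * sum (map f xs)
  sum-map-*ˡ a f []       = ≈-sym (zeroʳ a)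
  sum-map-*ˡ a f (x ∷ xs) = ≈-trans (+-congˡ (sum-map-*ˡ a f xs)) (≈-sym (distribˡ a (f x) _))

  sum-concatMap : ∀ (f : B → Carrier) (g : A → List B) xs →
                  sum (map f (concatMap g xs)) ≈ sum (map (λ x → sum (map f (g x))) xs)
  sum-concatMap f g []       = ≈-refl
  sum-concatMap f g (x ∷ xs) = begin
    sum (map f (g x ++ concatMap g xs))               ≡⟨ cong sum (map-++ f (g x) _) ⟩
    sum (map f (g x) ++ map f (concatMap g xs))       ≈⟨ sum-++ (map f (g x)) _ ⟩
    sum (map f (g x)) + sum (map f (concatMap g xs))  ≈⟨ +-congˡ (sum-concatMap f g xs) ⟩
    sum (map f (g x)) + sum (map (λ x → sum (map f (g x))) xs) ∎

  sum-map-comm : ∀ (f : A → B → Carrier) xs ys →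
                 sum (map (λ x → sum (map (f x) ys)) xs) ≈ sum (map (λ y → sum (map (λ x → f x y) xs)) ys)
  sum-map-comm f []       ys = ≈-sym (sum-map-zero (λ _ → ≈-refl) ys)
  sum-map-comm f (x ∷ xs) ys = ≈-trans (+-congˡ (sum-map-comm f xs ys)) (≈-sym (sum-map-+ (f x) _ ys))

module ℕΣ = ListSum ℕP.+-*-commutativeSemiring
module ℤΣ = ListSum ℤP.+-*-commutativeSemiring

private variable A : Set

𝟙 : {P : Set} → Dec P → ℕ
𝟙 P? = if does P? then 1 else 0

nonEmpty : List A → ℕ
nonEmpty []      = 0
nonEmpty (_ ∷ _) = 1

module _ {P : A → Set} (P? : Decidable P) where

  length-filter≡sum-𝟙 : ∀ xs → length (filter P? xs) ≡ sumℕ (map (λ x → 𝟙 (P? x)) xs)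
  length-filter≡sum-𝟙 []       = refl
  length-filter≡sum-𝟙 (x ∷ xs) with P? x
  ... | yes _ = cong suc (length-filter≡sum-𝟙 xs)
  ... | no  _ = length-filter≡sum-𝟙 xs

  nonEmpty-filter : ∀ xs → nonEmpty (filter P? xs) ≡ 𝟙 (any? P? xs)
  nonEmpty-filter []       = refl
  nonEmpty-filter (x ∷ xs) with P? x
  ... | yes _ = refl
  ... | no  _ = nonEmpty-filter xs

𝟙-cong : {P Q : Set} (P? : Dec P) (Q? : Dec Q) → P ⇔ Q → 𝟙 P? ≡ 𝟙 Q?
𝟙-cong P? Q? P⇔Q = cong (λ b → if b then 1 else 0) (does-⇔ P⇔Q P? Q?)

pos-sum : ∀ (f : A → ℕ) xs → + sumℕ (map f xs) ≡ ℤΣ.sum (map (λ x → + f x) xs)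
pos-sum f []       = refl
pos-sum f (x ∷ xs) = trans (ℤP.pos-+ (f x) _) (cong (λ s → + f x ℤ.+ s) (pos-sum f xs))

unique-complete⇒↭ : {xs ys : List A} → Unique xs → Unique ys →
                    (∀ x → x ∈ xs) → (∀ x → x ∈ ys) → xs ↭ ys
unique-complete⇒↭ !xs !ys xs-complete ys-complete =
  ∼bag⇒↭ (unique∧set⇒bag !xs !ys (mk⇔ (λ _ → ys-complete _) (λ _ → xs-complete _)))

upTo-suc : ∀ n → upTo (suc n) ≡ 0 ∷ map suc (upTo n)
upTo-suc n = cong (0 ∷_) (sym (map-upTo suc n))

sgn : ℕ → ℤ
sgn r = (ℤ.- (+ 1)) ℤ.^ r

module _ (K : FiniteField) where

  length-choose-∷ : ∀ r (x : A) xs →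
                    length (choose K (suc r) (x ∷ xs)) ≡ length (choose K r xs) ℕ.+ length (choose K (suc r) xs)
  length-choose-∷ r x xs =
    trans (length-++ (map (x ∷_) (choose K r xs))) (cong (ℕ._+ _) (length-map (x ∷_) (choose K r xs)))

  module _ {Q : A → Set} (Q? : Decidable Q) where

    filter-all?-map-∷ : ∀ {x} → Q x → ∀ Xs →
                        filter (all? Q?) (map (x ∷_) Xs) ≡ map (x ∷_) (filter (all? Q?) Xs)
    filter-all?-map-∷ qx []       = refl
    filter-all?-map-∷ {x} qx (X ∷ Xs) with Q? x | all? Q? X
    ... | no ¬qx | _     = contradiction qx ¬qx
    ... | yes _  | yes _ = cong (_ ∷_) (filter-all?-map-∷ qx Xs)
    ... | yes _  | no _  = filter-all?-map-∷ qx Xs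

    filter-all?-map-∷-reject : ∀ {x} → ¬ Q x → ∀ Xs → filter (all? Q?) (map (x ∷_) Xs) ≡ []
    filter-all?-map-∷-reject ¬qx []       = refl
    filter-all?-map-∷-reject {x} ¬qx (X ∷ Xs) with Q? x
    ... | yes qx = contradiction qx ¬qx
    ... | no _   = filter-all?-map-∷-reject ¬qx Xs

    choose-filter : ∀ r xs → choose K r (filter Q? xs) ≡ filter (all? Q?) (choose K r xs)
    choose-filter zero    xs       = refl
    choose-filter (suc r) []       = refl
    choose-filter (suc r) (x ∷ xs) with Q? x
    ... | yes qx = begin
      map (x ∷_) (choose K r (filter Q? xs)) ++ choose K (suc r) (filter Q? xs)
        ≡⟨ cong₂ (λ Ys Zs → map (x ∷_) Ys ++ Zs) (choose-filter r xs) (choose-filter (suc r) xs) ⟩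
      map (x ∷_) (filter (all? Q?) (choose K r xs)) ++ filter (all? Q?) (choose K (suc r) xs)
        ≡⟨ cong (_++ _) (filter-all?-map-∷ qx (choose K r xs)) ⟨
      filter (all? Q?) (map (x ∷_) (choose K r xs)) ++ filter (all? Q?) (choose K (suc r) xs)
        ≡⟨ filter-++ (all? Q?) (map (x ∷_) (choose K r xs)) _ ⟨
      filter (all? Q?) (choose K (suc r) (x ∷ xs)) ∎
      where open ≡-Reasoning
    ... | no ¬qx = begin
      choose K (suc r) (filter Q? xs)
        ≡⟨ choose-filter (suc r) xs ⟩
      filter (all? Q?) (choose K (suc r) xs)
        ≡⟨ cong (_++ _) (filter-all?-map-∷-reject ¬qx (choose K r xs)) ⟨
      filter (all? Q?) (map (x ∷_) (choose K r xs)) ++ filter (all? Q?) (choose K (suc r) xs)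
        ≡⟨ filter-++ (all? Q?) (map (x ∷_) (choose K r xs)) _ ⟨
      filter (all? Q?) (choose K (suc r) (x ∷ xs)) ∎
      where open ≡-Reasoning

  altChooseSum : ℕ → List A → ℤ
  altChooseSum d xs = ℤΣ.sum (map (λ r → sgn r ℤ.* + length (choose K (suc r) xs)) (upTo d))

  altChooseSum-∷ : ∀ d (x : A) xs →
                   altChooseSum (suc d) (x ∷ xs) ≡ (+ 1 ℤ.- altChooseSum d xs) ℤ.+ altChooseSum (suc d) xs
  altChooseSum-∷ d x xs = begin
    altChooseSum (suc d) (x ∷ xs)
      ≡⟨ cong ℤΣ.sum (map-cong pascal (upTo (suc d))) ⟩
    ℤΣ.sum (map (λ r → term r ℤ.+ sgn r ℤ.* c (suc r)) (upTo (suc d)))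
      ≡⟨ ℤΣ.sum-map-+ term (λ r → sgn r ℤ.* c (suc r)) (upTo (suc d)) ⟩
    ℤΣ.sum (map term (upTo (suc d))) ℤ.+ altChooseSum (suc d) xs
      ≡⟨ cong (λ ys → ℤΣ.sum (map term ys) ℤ.+ altChooseSum (suc d) xs) (upTo-suc d) ⟩
    (+ 1 ℤ.+ ℤΣ.sum (map term (map suc (upTo d)))) ℤ.+ altChooseSum (suc d) xs
      ≡⟨ cong (λ s → (+ 1 ℤ.+ s) ℤ.+ altChooseSum (suc d) xs) shifted ⟩
    (+ 1 ℤ.- altChooseSum d xs) ℤ.+ altChooseSum (suc d) xs ∎
    where
    open ≡-Reasoning
    c : ℕ → ℤ
    c r = + length (choose K r xs)
    term : ℕ → ℤ
    term r = sgn r ℤ.* c r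
    pascal : ∀ r → sgn r ℤ.* + length (choose K (suc r) (x ∷ xs)) ≡ term r ℤ.+ sgn r ℤ.* c (suc r)
    pascal r = begin
      sgn r ℤ.* + length (choose K (suc r) (x ∷ xs))
        ≡⟨ cong (λ n → sgn r ℤ.* + n) (length-choose-∷ r x xs) ⟩
      sgn r ℤ.* + (length (choose K r xs) ℕ.+ length (choose K (suc r) xs))
        ≡⟨ cong (sgn r ℤ.*_) (ℤP.pos-+ (length (choose K r xs)) _) ⟩
      sgn r ℤ.* (c r ℤ.+ c (suc r))
        ≡⟨ ℤP.*-distribˡ-+ (sgn r) (c r) _ ⟩
      term r ℤ.+ sgn r ℤ.* c (suc r) ∎
    shifted : ℤΣ.sum (map term (map suc (upTo d))) ≡ ℤ.- altChooseSum d xs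
    shifted = begin
      ℤΣ.sum (map term (map suc (upTo d)))
        ≡⟨ cong ℤΣ.sum (map-∘ (upTo d)) ⟨
      ℤΣ.sum (map (λ r → ((ℤ.- (+ 1)) ℤ.* sgn r) ℤ.* c (suc r)) (upTo d))
        ≡⟨ cong ℤΣ.sum (map-cong (λ r → ℤP.*-assoc (ℤ.- (+ 1)) (sgn r) _) (upTo d)) ⟩
      ℤΣ.sum (map (λ r → (ℤ.- (+ 1)) ℤ.* (sgn r ℤ.* c (suc r))) (upTo d))
        ≡⟨ ℤΣ.sum-map-*ˡ (ℤ.- (+ 1)) _ (upTo d) ⟩
      (ℤ.- (+ 1)) ℤ.* altChooseSum d xs
        ≡⟨ ℤP.-1*i≡-i _ ⟩
      ℤ.- altChooseSum d xs ∎

  altChooseSum-nonEmpty : ∀ d (xs : List A) → length xs ≤ d → altChooseSum d xs ≡ + nonEmpty xs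
  altChooseSum-nonEmpty d       []       _            = ℤΣ.sum-map-zero (λ r → ℤP.*-zeroʳ (sgn r)) (upTo d)
  altChooseSum-nonEmpty (suc d) (x ∷ xs) (s≤s |xs|≤d) = begin
    altChooseSum (suc d) (x ∷ xs)
      ≡⟨ altChooseSum-∷ d x xs ⟩
    (+ 1 ℤ.- altChooseSum d xs) ℤ.+ altChooseSum (suc d) xs
      ≡⟨ cong₂ (λ a b → (+ 1 ℤ.- a) ℤ.+ b) (altChooseSum-nonEmpty d xs |xs|≤d)
                                            (altChooseSum-nonEmpty (suc d) xs (ℕP.m≤n⇒m≤1+n |xs|≤d)) ⟩
    (+ 1 ℤ.- n) ℤ.+ n
      ≡⟨ ℤP.+-assoc (+ 1) (ℤ.- n) n ⟩
    + 1 ℤ.+ (ℤ.- n ℤ.+ n)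
      ≡⟨ cong (λ z → + 1 ℤ.+ z) (ℤP.+-inverseˡ n) ⟩
    + 1 ∎
    where
    open ≡-Reasoning
    n : ℤ
    n = + nonEmpty xs

module FieldProperties (K : FiniteField) where
  open FiniteField K

  ring : CommutativeRing 0ℓ 0ℓ
  ring = record { isCommutativeRing = isCommutativeRing }

  open CommutativeRing ring
    using (_-_; +-assoc; +-identityˡ; +-identityʳ; *-identityˡ; *-identityʳ; zeroʳ; distribˡ
          ; +-commutativeSemigroup; *-commutativeSemigroup; commutativeSemiring)
  open import Algebra.Properties.Ring (CommutativeRing.ring ring)
    using (x∙y⁻¹≈ε⇒x≈y; //-rightDividesˡ; -‿involutive; -‿injective; +-cancelˡ)
  open import Algebra.Properties.CommutativeSemigroup +-commutativeSemigroup using (interchange)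
  open import Algebra.Properties.CommutativeSemigroup *-commutativeSemigroup using (x∙yz≈y∙xz; xy∙z≈y∙xz)
  open import Algebra.Solver.Ring.NaturalCoefficients.Default commutativeSemiring using (solve; _:=_; _:+_; _:*_)
  open ≡-Reasoning

  x≢0⇒x*y≡0⇒y≡0 : ∀ {x y} → x ≢ 0# → x * y ≡ 0# → y ≡ 0#
  x≢0⇒x*y≡0⇒y≡0 {x} {y} x≢0 xy≡0 with inverse x x≢0
  ... | x⁻¹ , xx⁻¹≡1 = begin
    y             ≡⟨ *-identityˡ y ⟨
    1# * y        ≡⟨ cong (_* y) xx⁻¹≡1 ⟨
    (x * x⁻¹) * y ≡⟨ xy∙z≈y∙xz x x⁻¹ y ⟩
    x⁻¹ * (x * y) ≡⟨ cong (x⁻¹ *_) xy≡0 ⟩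
    x⁻¹ * 0#      ≡⟨ zeroʳ x⁻¹ ⟩
    0#            ∎

  -- f is a polynomial function of degree at most n with coefficient ℓ at xⁿ, in Horner form.
  Polynomial : ℕ → F → (F → F) → Set
  Polynomial zero    ℓ f = ∀ x → f x ≡ ℓ
  Polynomial (suc n) ℓ f = Σ[ g ∈ (F → F) ] Σ[ c ∈ F ] Polynomial n ℓ g × (∀ x → f x ≡ x * g x + c)

  private variable
    n : ℕ
    ℓ ℓ′ : F
    f g : F → F

  polynomial-cong : (∀ x → f x ≡ g x) → Polynomial n ℓ f → Polynomial n ℓ g
  polynomial-cong {n = zero}  f≗g f≡ℓ              = λ x → trans (sym (f≗g x)) (f≡ℓ x)
  polynomial-cong {n = suc n} f≗g (h , c , ph , f≡) = h , c , ph , λ x → trans (sym (f≗g x)) (f≡ x)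

  polynomial-leading-cong : ℓ ≡ ℓ′ → Polynomial n ℓ f → Polynomial n ℓ′ f
  polynomial-leading-cong {n = n} {f = f} = subst (λ ℓ → Polynomial n ℓ f)

  polynomial-+ : Polynomial n ℓ f → Polynomial n ℓ′ g → Polynomial n (ℓ + ℓ′) (λ x → f x + g x)
  polynomial-+ {n = zero}  f≡ℓ g≡ℓ′ = λ x → cong₂ _+_ (f≡ℓ x) (g≡ℓ′ x)
  polynomial-+ {n = suc n} {f = f} {g = g} (f₁ , c , pf₁ , f≡) (g₁ , d , pg₁ , g≡) =
    (λ x → f₁ x + g₁ x) , c + d , polynomial-+ pf₁ pg₁ , λ x → begin
      f x + g x                         ≡⟨ cong₂ _+_ (f≡ x) (g≡ x) ⟩
      (x * f₁ x + c) + (x * g₁ x + d)   ≡⟨ interchange (x * f₁ x) c (x * g₁ x) d ⟩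
      (x * f₁ x + x * g₁ x) + (c + d)   ≡⟨ cong (_+ (c + d)) (distribˡ x (f₁ x) (g₁ x)) ⟨
      x * (f₁ x + g₁ x) + (c + d)       ∎

  polynomial-monomial : ∀ n a → Polynomial n a (λ x → a * x ^ n)
  polynomial-monomial zero    a = λ x → *-identityʳ a
  polynomial-monomial (suc n) a =
    (λ x → a * x ^ n) , 0# , polynomial-monomial n a ,
    λ x → trans (x∙yz≈y∙xz a x (x ^ n)) (sym (+-identityʳ _))

  polynomial-lift : Polynomial n ℓ f → Polynomial (suc n) 0# f
  polynomial-lift {n = zero}  {ℓ = ℓ} f≡ℓ =
    (λ _ → 0#) , ℓ , (λ _ → refl) ,
    λ x → trans (f≡ℓ x) (sym (trans (cong (_+ ℓ) (zeroʳ x)) (+-identityˡ ℓ)))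
  polynomial-lift {n = suc n} (g , c , pg , f≡) = g , c , polynomial-lift pg , f≡

  [x-r]+r≡x : ∀ x r → (x - r) + r ≡ x
  [x-r]+r≡x x r = //-rightDividesˡ r x

  -- Substituting x = (x - r) + r turns each division step into one of these semiring identities.
  horner-shift₀ : ∀ s r ℓ c → (s + r) * ℓ + c ≡ s * ℓ + (r * ℓ + c)
  horner-shift₀ = solve 4 (λ s r ℓ c → (s :+ r) :* ℓ :+ c := s :* ℓ :+ (r :* ℓ :+ c)) refl

  horner-shift : ∀ s r q g c → (s + r) * (s * q + g) + c ≡ s * ((s + r) * q + g) + (r * g + c)
  horner-shift = solve 5 (λ s r q g c → (s :+ r) :* (s :* q :+ g) :+ c
                                      := s :* ((s :+ r) :* q :+ g) :+ (r :* g :+ c)) refl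

  polynomial-divide : Polynomial (suc n) ℓ f → ∀ r →
                      Σ[ h ∈ (F → F) ] Polynomial n ℓ h × (∀ x → f x ≡ (x - r) * h x + f r)
  polynomial-divide {n = zero} {ℓ = ℓ} {f = f} (g , c , g≡ℓ , f≡) r = (λ _ → ℓ) , (λ _ → refl) , λ x → begin
    f x                               ≡⟨ f≡ x ⟩
    x * g x + c                       ≡⟨ cong (λ y → x * y + c) (g≡ℓ x) ⟩
    x * ℓ + c                         ≡⟨ cong (λ y → y * ℓ + c) ([x-r]+r≡x x r) ⟨
    ((x - r) + r) * ℓ + c             ≡⟨ horner-shift₀ (x - r) r ℓ c ⟩
    (x - r) * ℓ + (r * ℓ + c)         ≡⟨ cong (λ y → (x - r) * ℓ + (r * y + c)) (g≡ℓ r) ⟨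
    (x - r) * ℓ + (r * g r + c)       ≡⟨ cong (λ z → (x - r) * ℓ + z) (f≡ r) ⟨
    (x - r) * ℓ + f r                 ∎
  polynomial-divide {n = suc n} {f = f} (g , c , pg , f≡) r with polynomial-divide pg r
  ... | q , pq , g≡ = (λ x → x * q x + g r) , (q , g r , pq , λ x → refl) , λ x → begin
    f x                                         ≡⟨ f≡ x ⟩
    x * g x + c                                 ≡⟨ cong (λ y → x * y + c) (g≡ x) ⟩
    x * ((x - r) * q x + g r) + c               ≡⟨ cong (λ y → y * ((x - r) * q x + g r) + c) ([x-r]+r≡x x r) ⟨
    ((x - r) + r) * ((x - r) * q x + g r) + c   ≡⟨ horner-shift (x - r) r (q x) (g r) c ⟩
    (x - r) * (((x - r) + r) * q x + g r) + (r * g r + c)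
                                                ≡⟨ cong (λ y → (x - r) * (y * q x + g r) + (r * g r + c)) ([x-r]+r≡x x r) ⟩
    (x - r) * (x * q x + g r) + (r * g r + c)   ≡⟨ cong (λ z → (x - r) * (x * q x + g r) + z) (f≡ r) ⟨
    (x - r) * (x * q x + g r) + f r             ∎

  roots-bound : ℓ ≢ 0# → Polynomial n ℓ f → ∀ {rs} → Unique rs → All (λ x → f x ≡ 0#) rs → length rs ≤ n
  roots-bound ℓ≢0 pf {[]} _ _ = z≤n
  roots-bound {n = zero} ℓ≢0 f≡ℓ {r ∷ _} _ (fr≡0 ∷ _) = contradiction (trans (sym (f≡ℓ r)) fr≡0) ℓ≢0
  roots-bound {n = suc n} {f = f} ℓ≢0 pf {r ∷ rs} (r∉rs ∷ !rs) (fr≡0 ∷ frs≡0)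
    with polynomial-divide pf r
  ... | h , ph , f≡ = s≤s (roots-bound ℓ≢0 ph !rs (All.zipWith root-of-h (r∉rs , frs≡0)))
    where
    root-of-h : ∀ {x} → r ≢ x × f x ≡ 0# → h x ≡ 0#
    root-of-h {x} (r≢x , fx≡0) = x≢0⇒x*y≡0⇒y≡0 (λ x-r≡0 → r≢x (sym (x∙y⁻¹≈ε⇒x≈y x r x-r≡0))) (begin
      (x - r) * h x        ≡⟨ +-identityʳ _ ⟨
      (x - r) * h x + 0#   ≡⟨ cong (λ z → (x - r) * h x + z) fr≡0 ⟨
      (x - r) * h x + f r  ≡⟨ f≡ x ⟨
      f x                  ≡⟨ fx≡0 ⟩
      0#                   ∎)

  lowerTerms : ∀ {k} → F → Vec F k → F
  lowerTerms         x []       = 0#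
  lowerTerms {suc k} x (a ∷ as) = a * x ^ suc k + lowerTerms x as

  -- The local sum inside evalF cannot be named, so the equation for the tail is recovered
  -- by cancelling x ^ suc k from the previous instance.
  evalF-split : ∀ k (v : Vec F k) x → evalF K (suc k) v x ≡ x ^ suc k + lowerTerms x v
  evalF-split zero    []       x = refl
  evalF-split (suc k) (a ∷ as) x =
    cong (λ z → x ^ suc (suc k) + (a * x ^ suc k + z)) (+-cancelˡ (x ^ suc k) _ _ (evalF-split k as x))

  lowerTerms-polynomial : ∀ k (v : Vec F k) a₀ → Polynomial (suc k) 0# (λ x → lowerTerms x v + a₀)
  lowerTerms-polynomial zero    []       a₀ = polynomial-lift {n = zero} (λ _ → +-identityˡ a₀)
  lowerTerms-polynomial (suc k) (a ∷ as) a₀ =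
    polynomial-cong (λ x → sym (+-assoc (a * x ^ suc k) _ a₀))
      (polynomial-leading-cong (+-identityʳ 0#)
        (polynomial-+ (polynomial-lift (polynomial-monomial (suc k) a))
                      (polynomial-lift (lowerTerms-polynomial k as a₀))))

  evalF-monic : ∀ k (v : Vec F k) a₀ → Polynomial (suc k) 1# (λ x → evalF K (suc k) v x + a₀)
  evalF-monic k v a₀ =
    polynomial-cong (λ x → trans (sym (+-assoc (x ^ suc k) _ a₀)) (cong (_+ a₀) (sym (evalF-split k v x))))
      (polynomial-leading-cong (+-identityʳ 1#)
        (polynomial-+ (polynomial-cong (λ x → *-identityˡ (x ^ suc k)) (polynomial-monomial (suc k) 1#))
                      (lowerTerms-polynomial k v a₀)))

  sum-map-neg : ∀ (h : F → ℕ) → sumℕ (map (λ y → h (- y)) elems) ≡ sumℕ (map h elems)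
  sum-map-neg h = trans (cong sumℕ (map-∘ elems)) (sum-↭ (↭.map⁺ h neg-elems↭elems))
    where
    neg-elems↭elems : map -_ elems ↭ elems
    neg-elems↭elems = unique-complete⇒↭ (Unique.map⁺ -‿injective elems-unique) elems-unique
      (λ y → subst (_∈ map -_ elems) (-‿involutive y) (∈-map⁺ -_ (elems-complete (- y))))
      elems-complete


module CountingIdentity (K : FiniteField) (k m : ℕ) (G : Vec (MPoly K k) m) where
  open FiniteField K
  open FieldProperties K
  open import Algebra.Properties.Ring (CommutativeRing.ring ring) using (+-inverseˡ-unique)
  open CommutativeRing ring using (-‿inverseˡ)
  open ≡-Reasoning

  d : ℕ
  d = suc k

  IsRoot : Vec F k × F → F → Set
  IsRoot (a , a₀) x = evalF K d a x + a₀ ≡ 0#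

  isRoot? : ∀ p → Decidable (IsRoot p)
  isRoot? (a , a₀) x = (evalF K d a x + a₀) ≟ 0#

  roots : Vec F k × F → List F
  roots p = filter (isRoot? p) elems

  pairs : List (Vec F k × F)
  pairs = concatMap (λ a → map (a ,_) elems) (𝒜 K d m G)

  roots-length : ∀ p → length (roots p) ≤ d
  roots-length p@(a , a₀) =
    roots-bound (λ 1≡0 → 0≢1 (sym 1≡0)) (evalF-monic k a a₀)
                (Unique.filter⁺ (isRoot? p) elems-unique) (all-filter (isRoot? p) elems)

  sum-card-𝒮 : ∀ r → sumℕ (map (λ X → length (𝒮 K d m G X)) (choose K r elems))
                     ≡ sumℕ (map (λ p → length (choose K r (roots p))) pairs)
  sum-card-𝒮 r = begin
    sumℕ (map (λ X → length (𝒮 K d m G X)) (choose K r elems))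
      ≡⟨ cong sumℕ (map-cong (λ X → length-filter≡sum-𝟙 _ pairs) (choose K r elems)) ⟩
    sumℕ (map (λ X → sumℕ (map (λ p → 𝟙 (all? (isRoot? p) X)) pairs)) (choose K r elems))
      ≡⟨ ℕΣ.sum-map-comm (λ X p → 𝟙 (all? (isRoot? p) X)) (choose K r elems) pairs ⟩
    sumℕ (map (λ p → sumℕ (map (λ X → 𝟙 (all? (isRoot? p) X)) (choose K r elems))) pairs)
      ≡⟨ cong sumℕ (map-cong (λ p → length-filter≡sum-𝟙 (all? (isRoot? p)) (choose K r elems)) pairs) ⟨
    sumℕ (map (λ p → length (filter (all? (isRoot? p)) (choose K r elems))) pairs)
      ≡⟨ cong sumℕ (map-cong (λ p → cong length (choose-filter K (isRoot? p) r elems)) pairs) ⟨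
    sumℕ (map (λ p → length (choose K r (roots p))) pairs) ∎

  inclExcl≡sum-nonEmpty-roots : inclExcl K d m G ≡ + sumℕ (map (λ p → nonEmpty (roots p)) pairs)
  inclExcl≡sum-nonEmpty-roots = begin
    inclExcl K d m G
      ≡⟨ cong ℤΣ.sum (map-∘ {g = λ r → sgn (r ∸ 1) ℤ.* + S r} {f = suc} (upTo d)) ⟨
    ℤΣ.sum (map (λ r → sgn r ℤ.* + S (suc r)) (upTo d))
      ≡⟨ cong ℤΣ.sum (map-cong (λ r → cong (λ n → sgn r ℤ.* + n) (sum-card-𝒮 (suc r))) (upTo d)) ⟩
    ℤΣ.sum (map (λ r → sgn r ℤ.* + sumℕ (map (λ p → length (choose K (suc r) (roots p))) pairs)) (upTo d))
      ≡⟨ cong ℤΣ.sum (map-cong distribute (upTo d)) ⟩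
    ℤΣ.sum (map (λ r → ℤΣ.sum (map (λ p → term r p) pairs)) (upTo d))
      ≡⟨ ℤΣ.sum-map-comm term (upTo d) pairs ⟩
    ℤΣ.sum (map (λ p → altChooseSum K d (roots p)) pairs)
      ≡⟨ cong ℤΣ.sum (map-cong (λ p → altChooseSum-nonEmpty K d (roots p) (roots-length p)) pairs) ⟩
    ℤΣ.sum (map (λ p → + nonEmpty (roots p)) pairs)
      ≡⟨ pos-sum (λ p → nonEmpty (roots p)) pairs ⟨
    + sumℕ (map (λ p → nonEmpty (roots p)) pairs) ∎
    where
    S : ℕ → ℕ
    S r = sumℕ (map (λ X → length (𝒮 K d m G X)) (choose K r elems))
    term : ℕ → Vec F k × F → ℤ
    term r p = sgn r ℤ.* + length (choose K (suc r) (roots p))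
    distribute : ∀ r → sgn r ℤ.* + sumℕ (map (λ p → length (choose K (suc r) (roots p))) pairs)
                       ≡ ℤΣ.sum (map (term r) pairs)
    distribute r = trans (cong (sgn r ℤ.*_) (pos-sum (λ p → length (choose K (suc r) (roots p))) pairs))
                         (sym (ℤΣ.sum-map-*ˡ (sgn r) (λ p → + length (choose K (suc r) (roots p))) pairs))

  sum-nonEmpty-roots≡V : ∀ a → sumℕ (map (λ a₀ → nonEmpty (roots (a , a₀))) elems) ≡ V K d a
  sum-nonEmpty-roots≡V a = begin
    sumℕ (map (λ a₀ → nonEmpty (roots (a , a₀))) elems)
      ≡⟨ cong sumℕ (map-cong (λ a₀ → nonEmpty-filter (isRoot? (a , a₀)) elems) elems) ⟩
    sumℕ (map (λ a₀ → 𝟙 (any? (isRoot? (a , a₀)) elems)) elems)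
      ≡⟨ cong sumℕ (map-cong 𝟙-root≡𝟙-value elems) ⟩
    sumℕ (map (λ a₀ → 𝟙 (any? (λ x → evalF K d a x ≟ (- a₀)) elems)) elems)
      ≡⟨ sum-map-neg (λ y → 𝟙 (any? (λ x → evalF K d a x ≟ y) elems)) ⟩
    sumℕ (map (λ y → 𝟙 (any? (λ x → evalF K d a x ≟ y) elems)) elems)
      ≡⟨ length-filter≡sum-𝟙 (λ y → any? (λ x → evalF K d a x ≟ y) elems) elems ⟨
    V K d a ∎
    where
    root⇒value : ∀ a₀ {x} → IsRoot (a , a₀) x → evalF K d a x ≡ - a₀
    root⇒value a₀ {x} = +-inverseˡ-unique (evalF K d a x) a₀
    value⇒root : ∀ a₀ {x} → evalF K d a x ≡ - a₀ → IsRoot (a , a₀) x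
    value⇒root a₀ fx≡-a₀ = trans (cong (_+ a₀) fx≡-a₀) (-‿inverseˡ a₀)
    𝟙-root≡𝟙-value : ∀ a₀ → 𝟙 (any? (isRoot? (a , a₀)) elems) ≡ 𝟙 (any? (λ x → evalF K d a x ≟ (- a₀)) elems)
    𝟙-root≡𝟙-value a₀ = 𝟙-cong (any? (isRoot? (a , a₀)) elems) (any? (λ x → evalF K d a x ≟ (- a₀)) elems)
                               (mk⇔ (Any.map (root⇒value a₀)) (Any.map (value⇒root a₀)))

  sum-V≡sum-nonEmpty-roots : sumℕ (map (V K d) (𝒜 K d m G)) ≡ sumℕ (map (λ p → nonEmpty (roots p)) pairs)
  sum-V≡sum-nonEmpty-roots = begin
    sumℕ (map (V K d) (𝒜 K d m G))
      ≡⟨ cong sumℕ (map-cong (λ a → trans (sym (sum-nonEmpty-roots≡V a)) (cong sumℕ (map-∘ elems)))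
                             (𝒜 K d m G)) ⟩
    sumℕ (map (λ a → sumℕ (map (λ p → nonEmpty (roots p)) (map (a ,_) elems))) (𝒜 K d m G))
      ≡⟨ ℕΣ.sum-concatMap (λ p → nonEmpty (roots p)) (λ a → map (a ,_) elems) (𝒜 K d m G) ⟨
    sumℕ (map (λ p → nonEmpty (roots p)) pairs) ∎

  counting-identity : + sumℕ (map (V K d) (𝒜 K d m G)) ≡ inclExcl K d m G
  counting-identity = trans (cong +_ sum-V≡sum-nonEmpty-roots) (sym inclExcl≡sum-nonEmpty-roots)

open import Data.Nat using (_+_; _^_)

lemma3p1 : (K : FiniteField) (p s d m : ℕ) → Prime p → FiniteField.card K ≡ p ^ s →
    1 ≤ d → 1 ≤ m → d < FiniteField.card K → m + 2 ≤ d →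
    (G : Vec (MPoly K (d ∸ 1)) m) → (ne : card𝒜 K d m G ≢ 0) →
    V𝒜 K d m G {{≢-nonZero ne}} ≡ RHS K d m G {{≢-nonZero ne}}
lemma3p1 K p s (suc k) m _ _ (s≤s z≤n) _ _ _ G ne =
  cong (λ z → (+ 1 ℚ./ card𝒜 K (suc k) m G) ℚ.* (z ℚ./ 1)) (CountingIdentity.counting-identity K k m G)
  where
  instance
    card𝒜-nonZero : NonZero (card𝒜 K (suc k) m G)
    card𝒜-nonZero = ≢-nonZero ne
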